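{- Let $a\in\{0,1\}$ and $\ell\ge 2$. The word $a^\ell$ satisfies Property P if and only if $\ell$ is a power of $2$.
   Context: For $n\ge 0$ and a word $w$ over $\{0,1\}$, $s_w(n)$ is the number of occurrences of $w$ as a scattered subsequence (not necessarily contiguous) of the binary expansion of $n$ without leading zeros (the binary expansion of $0$ is the word $0$). $a^\ell$ denotes the word consisting of $\ell$ copies of the letter $a$. A word $w$ satisfies Property P if there exists $\epsilon>0$ such that $\left|\sum_{n=0}^N(-1)^{s_w(n)}\right|=O(N^{1-\epsilon})$ as $N\to\infty$. -}

module Defs where

open import Data.Nat using (ℕ; zero; suc; _+_; _*_; _^_; _≤_; _<_)
open import Data.Nat.DivMod using (_/_; _mod_)
open import Data.Fin using (Fin)
import Data.Fin as F
open import Data.Fin.Properties using (_≟_)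
open import Data.List using (List; []; _∷_; _++_; [_])
open import Data.Integer using (ℤ; -[1+_]; ∣_∣) renaming (_+_ to _+ℤ_; _^_ to _^ℤ_)
open import Data.Product using (∃; _×_; ∃-syntax)
open import Relation.Nullary using (yes; no)

-- Binary digits (most significant first) of a number, with fuel.
-- Fuel n is enough for the number n since n / 2 < n for n > 0.
binGo : ℕ → ℕ → List (Fin 2)
binGo zero    _       = []
binGo (suc f) zero    = []
binGo (suc f) (suc m) = binGo f (suc m / 2) ++ [ suc m mod 2 ]

bin : ℕ → List (Fin 2)
bin zero    = [ F.zero ]
bin (suc m) = binGo (suc m) (suc m)

-- occ u w = number of occurrences of w as a scattered subsequence of u.
occ : List (Fin 2) → List (Fin 2) → ℕ
occ u       []      = 1
occ []      (x ∷ w) = 0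
occ (y ∷ u) (x ∷ w) with y ≟ x
... | yes _ = occ u w + occ u (x ∷ w)
... | no  _ = occ u (x ∷ w)

s : List (Fin 2) → ℕ → ℕ
s w n = occ (bin n) w

S : List (Fin 2) → ℕ → ℤ
S w zero    = -[1+ 0 ] ^ℤ s w 0
S w (suc N) = S w N +ℤ (-[1+ 0 ] ^ℤ s w (suc N))

-- Property P: ∃ ε > 0 with |S_w(N)| = O(N^{1-ε}).
-- ε may be taken rational, ε = p / q with p, q > 0; then
-- |S| ≤ C' N^{1-p/q}  (N ≥ N₀)  ⇔  |S|^q · N^p ≤ C · N^q  with C = ⌈C'^q⌉.
PropertyP : List (Fin 2) → Set
PropertyP w = ∃[ p ] ∃[ q ] ∃[ C ] ∃[ N₀ ]
  (0 < p × 0 < q × (∀ N → N₀ ≤ N → ∣ S w N ∣ ^ q * N ^ p ≤ C * N ^ q))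

IsPowerOf2 : ℕ → Set
IsPowerOf2 ℓ = ∃[ k ] ℓ ≡ 2 ^ k
  where open import Relation.Binary.PropositionalEquality using (_≡_)

{-# OPTIONS --safe #-}
-- Let f_ℓ k = (-1)^(k choose ℓ) and let w n be the number of digits a in the binary expansion
-- of n, so that the n-th summand of S is f_ℓ (w n).  The expansions of 2n and 2n + 1 extend that
-- of n by one digit, so w (2n) and w (2n + 1) are w n and w n + 1 in some order, and summing
-- φ ∘ w over n ≤ 2N + 1 amounts to summing (pairSum φ) ∘ w over n ≤ N, where
-- pairSum φ k = φ k + φ (k + 1).  Iterating, the sum up to N < 2^(ℓt) is controlled by the sup
-- norms of the iterates of pairSum on φ.  These grow like 2^i in general, but only like
-- (2^ℓ - 2)^(i/ℓ) when φ is antiperiodic with a period d ≤ ℓ, which gives the power saving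
-- O(N^(log(2^ℓ - 2) / log 2^ℓ)).
-- If ℓ = 2^j, Lucas' theorem makes f_ℓ itself ℓ-antiperiodic.  Otherwise ℓ = 2^j + t with
-- 0 < t < 2^j, and Lucas gives 2 f_ℓ = 1 + f_t + (a 2^j-antiperiodic function); by induction
-- on ℓ, σ f_ℓ = c + ψ with c ≥ 1 and ψ a combination of antiperiodic functions with periods
-- at most ℓ, so S N = (c / σ) N + O(N^(1-ε)) is not O(N^(1-ε)).
module Submission where

open import Defs
open import Data.Bool using (Bool; true; false; not; _∧_; _xor_)
open import Data.Bool.Properties using (xor-assoc; xor-comm; xor-same; xor-identityʳ)
open import Data.Fin using (Fin)
import Data.Fin as F
open import Data.Fin.Properties using (_≟_; fromℕ<-cong)
open import Data.Integer as ℤ using (ℤ; 0ℤ; 1ℤ; -1ℤ; -_; ∣_∣)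
import Data.Integer.Properties as ℤₚ
open import Data.List using (List; []; _∷_; _++_; [_]; replicate)
open import Data.Nat hiding (_≟_)
open import Data.Nat.Properties hiding (_≟_)
open import Data.Nat.DivMod using (_/_; _%_; _mod_; m/n≡1+[m∸n]/n; m/n≤m; m%n<n; m≡m%n+[m/n]*n)
open import Data.Product using (∃-syntax; _×_; _,_)
open import Data.Sum using (_⊎_; inj₁; inj₂)
open import Function.Bundles using (_⇔_; mk⇔)
open import Function.Endo.Propositional (ℕ → ℤ) using (^-homo) renaming (_^_ to _^ᵉ_)
import Data.Nat.Tactic.RingSolver as ℕ-Solver
import Data.Integer.Tactic.RingSolver as ℤ-Solver
open import Relation.Binary.PropositionalEquality hiding ([_])
open import Relation.Nullary using (¬_; yes; no; contradiction)
open import Data.Empty using (⊥; ⊥-elim)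
open import Data.Nat.Induction using (<-rec)

-- Binary expansions

[1+n]/2≤n : ∀ n → suc n / 2 ≤ n
[1+n]/2≤n zero    = z≤n
[1+n]/2≤n (suc n) = begin
  suc (suc n) / 2 ≡⟨ m/n≡1+[m∸n]/n {suc (suc n)} {2} (s≤s (s≤s z≤n)) ⟩
  suc (n / 2)     ≤⟨ s≤s (m/n≤m n 2) ⟩
  suc n           ∎
  where open ≤-Reasoning

binGo-fuel : ∀ f g x → x ≤ f → x ≤ g → binGo f x ≡ binGo g x
binGo-fuel zero    zero    zero    _       _       = refl
binGo-fuel zero    (suc g) zero    _       _       = refl
binGo-fuel (suc f) zero    zero    _       _       = refl
binGo-fuel (suc f) (suc g) zero    _       _       = refl
binGo-fuel (suc f) (suc g) (suc m) (s≤s p) (s≤s q) =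
  cong (_++ [ suc m mod 2 ]) (binGo-fuel f g (suc m / 2) (≤-trans h p) (≤-trans h q))
  where h = [1+n]/2≤n m

[n+n]/2≡n : ∀ n → (n + n) / 2 ≡ n
[n+n]/2≡n zero    = refl
[n+n]/2≡n (suc n) rewrite +-suc n n =
  trans (m/n≡1+[m∸n]/n {suc (suc (n + n))} {2} (s≤s (s≤s z≤n))) (cong suc ([n+n]/2≡n n))

[1+n+n]/2≡n : ∀ n → suc (n + n) / 2 ≡ n
[1+n+n]/2≡n zero    = refl
[1+n+n]/2≡n (suc n) rewrite +-suc n n =
  trans (m/n≡1+[m∸n]/n {suc (suc (suc (n + n)))} {2} (s≤s (s≤s z≤n))) (cong suc ([1+n+n]/2≡n n))

[n+n]%2≡0 : ∀ n → (n + n) % 2 ≡ 0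
[n+n]%2≡0 zero    = refl
[n+n]%2≡0 (suc n) rewrite +-suc n n = [n+n]%2≡0 n

[1+n+n]%2≡1 : ∀ n → suc (n + n) % 2 ≡ 1
[1+n+n]%2≡1 zero    = refl
[1+n+n]%2≡1 (suc n) rewrite +-suc n n = [1+n+n]%2≡1 n

bin-double : ∀ n .{{_ : NonZero n}} → bin (n + n) ≡ bin n ++ [ F.zero ]
bin-double n@(suc m) = begin
  binGo (m + n) ((n + n) / 2) ++ [ (n + n) mod 2 ]
    ≡⟨ cong₂ (λ x d → binGo (m + n) x ++ [ d ]) ([n+n]/2≡n n)
             (fromℕ<-cong _ 0 ([n+n]%2≡0 n) (m%n<n (n + n) 2) (s≤s z≤n)) ⟩
  binGo (m + n) n ++ [ F.zero ]
    ≡⟨ cong (_++ [ F.zero ]) (binGo-fuel (m + n) n n n≤m+n ≤-refl) ⟩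
  bin n ++ [ F.zero ] ∎
  where
  open ≡-Reasoning
  n≤m+n : n ≤ m + n
  n≤m+n = m≤n+m n m

bin-double+1 : ∀ n .{{_ : NonZero n}} → bin (suc (n + n)) ≡ bin n ++ [ F.suc F.zero ]
bin-double+1 n@(suc m) = begin
  binGo (n + n) (suc (n + n) / 2) ++ [ suc (n + n) mod 2 ]
    ≡⟨ cong₂ (λ x d → binGo (n + n) x ++ [ d ]) ([1+n+n]/2≡n n)
             (fromℕ<-cong _ 1 ([1+n+n]%2≡1 n) (m%n<n (suc (n + n)) 2) (s≤s (s≤s z≤n))) ⟩
  binGo (n + n) n ++ [ F.suc F.zero ]
    ≡⟨ cong (_++ [ F.suc F.zero ]) (binGo-fuel (n + n) n n (m≤m+n n n) ≤-refl) ⟩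
  bin n ++ [ F.suc F.zero ] ∎
  where open ≡-Reasoning

count : Fin 2 → List (Fin 2) → ℕ
count a u = occ u [ a ]

count-++ : ∀ a u b → count a (u ++ [ b ]) ≡ count a u + count a [ b ]
count-++ a []      b = refl
count-++ a (y ∷ u) b with y ≟ a
... | yes _ = cong suc (count-++ a u b)
... | no  _ = count-++ a u b

-- Binomial coefficients mod 2

signOf : Bool → ℤ
signOf true  = -1ℤ
signOf false = 1ℤ

signOf-xor : ∀ x y → signOf (x xor y) ≡ signOf x ℤ.* signOf y
signOf-xor true  true  = refl
signOf-xor true  false = refl
signOf-xor false true  = refl
signOf-xor false false = refl

signOf-not : ∀ x → signOf (not x) ≡ - signOf x
signOf-not true  = refl
signOf-not false = refl

-- oddChoose k t ≡ true iff the binomial coefficient k choose t is odd: Pascal's rule mod 2.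
oddChoose : ℕ → ℕ → Bool
oddChoose k       zero    = true
oddChoose zero    (suc t) = false
oddChoose (suc k) (suc t) = oddChoose k t xor oddChoose k (suc t)

-- The occurrences of aᵗ in u are the t-element subsets of the occurrences of a.
sign-occ-replicate : ∀ a u t → -1ℤ ℤ.^ occ u (replicate t a) ≡ signOf (oddChoose (count a u) t)
sign-occ-replicate a []      zero    = refl
sign-occ-replicate a []      (suc t) = refl
sign-occ-replicate a (y ∷ u) zero    = refl
sign-occ-replicate a (y ∷ u) (suc t) with y ≟ a
... | no  _ = sign-occ-replicate a u (suc t)
... | yes _ = begin
  -1ℤ ℤ.^ (occ u (replicate t a) + occ u (replicate (suc t) a))
    ≡⟨ ℤₚ.^-distribˡ-+-* -1ℤ (occ u (replicate t a)) (occ u (replicate (suc t) a)) ⟩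
  -1ℤ ℤ.^ occ u (replicate t a) ℤ.* -1ℤ ℤ.^ occ u (replicate (suc t) a)
    ≡⟨ cong₂ ℤ._*_ (sign-occ-replicate a u t) (sign-occ-replicate a u (suc t)) ⟩
  signOf (oddChoose (count a u) t) ℤ.* signOf (oddChoose (count a u) (suc t))
    ≡⟨ sym (signOf-xor (oddChoose (count a u) t) (oddChoose (count a u) (suc t))) ⟩
  signOf (oddChoose (count a u) t xor oddChoose (count a u) (suc t)) ∎
  where open ≡-Reasoning

oddChoose-< : ∀ {k t} → k < t → oddChoose k t ≡ false
oddChoose-< {zero}  {suc t} _       = refl
oddChoose-< {suc k} {suc t} (s≤s p) rewrite oddChoose-< p | oddChoose-< (m≤n⇒m≤1+n p) = refl

2^[1+j]≡2^j+2^j : ∀ j → 2 ^ suc j ≡ 2 ^ j + 2 ^ j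
2^[1+j]≡2^j+2^j j = cong (λ x → 2 ^ j + x) (+-identityʳ (2 ^ j))

xor-telescope : ∀ x y z → (x xor y) xor (y xor z) ≡ x xor z
xor-telescope x y z = begin
  (x xor y) xor (y xor z) ≡⟨ xor-assoc x y (y xor z) ⟩
  x xor (y xor (y xor z)) ≡⟨ cong (x xor_) (sym (xor-assoc y y z)) ⟩
  x xor ((y xor y) xor z) ≡⟨ cong (λ b → x xor (b xor z)) (xor-same y) ⟩
  x xor z                 ∎
  where open ≡-Reasoning

xor-cancelʳ : ∀ x y → (x xor y) xor y ≡ x
xor-cancelʳ x y = trans (xor-assoc x y y) (trans (cong (x xor_) (xor-same y)) (xor-identityʳ x))

-- Row k + 2ʲ of Pascal's triangle mod 2 is row k plus row k shifted by 2ʲ,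
-- as (1 + X)^(2ʲ) ≡ 1 + X^(2ʲ) mod 2.
oddChoose-+2^-shifted : ∀ j k t → oddChoose (k + 2 ^ j) (2 ^ j + t) ≡ oddChoose k (2 ^ j + t) xor oddChoose k t
oddChoose-+2^-shifted zero    k t rewrite +-comm k 1 = xor-comm (oddChoose k t) (oddChoose k (suc t))
oddChoose-+2^-shifted (suc j) k t rewrite 2^[1+j]≡2^j+2^j j = begin
  oddChoose (k + (d + d)) ((d + d) + t)
    ≡⟨ cong₂ oddChoose (sym (+-assoc k d d)) (+-assoc d d t) ⟩
  oddChoose ((k + d) + d) (d + (d + t))
    ≡⟨ oddChoose-+2^-shifted j (k + d) (d + t) ⟩
  oddChoose (k + d) (d + (d + t)) xor oddChoose (k + d) (d + t)
    ≡⟨ cong₂ _xor_ (oddChoose-+2^-shifted j k (d + t)) (oddChoose-+2^-shifted j k t) ⟩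
  (oddChoose k (d + (d + t)) xor oddChoose k (d + t)) xor (oddChoose k (d + t) xor oddChoose k t)
    ≡⟨ xor-telescope (oddChoose k (d + (d + t))) (oddChoose k (d + t)) (oddChoose k t) ⟩
  oddChoose k (d + (d + t)) xor oddChoose k t
    ≡⟨ cong (λ z → oddChoose k z xor oddChoose k t) (sym (+-assoc d d t)) ⟩
  oddChoose k ((d + d) + t) xor oddChoose k t ∎
  where
  open ≡-Reasoning
  d = 2 ^ j

oddChoose-+2^ : ∀ j k {t} → t < 2 ^ j → oddChoose (k + 2 ^ j) t ≡ oddChoose k t
oddChoose-+2^ zero    k {zero}  _         = refl
oddChoose-+2^ zero    k {suc t} (s≤s ())
oddChoose-+2^ (suc j) k {t} t<2d rewrite 2^[1+j]≡2^j+2^j j with t <? 2 ^ j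
... | yes t<d = begin
  oddChoose (k + (d + d)) t ≡⟨ cong (λ z → oddChoose z t) (sym (+-assoc k d d)) ⟩
  oddChoose ((k + d) + d) t ≡⟨ oddChoose-+2^ j (k + d) t<d ⟩
  oddChoose (k + d) t       ≡⟨ oddChoose-+2^ j k t<d ⟩
  oddChoose k t             ∎
  where
  open ≡-Reasoning
  d = 2 ^ j
... | no t≮d = begin
  oddChoose (k + (d + d)) t
    ≡⟨ cong₂ oddChoose (sym (+-assoc k d d)) (sym d+t′≡t) ⟩
  oddChoose ((k + d) + d) (d + t′)
    ≡⟨ oddChoose-+2^-shifted j (k + d) t′ ⟩
  oddChoose (k + d) (d + t′) xor oddChoose (k + d) t′
    ≡⟨ cong₂ _xor_ (oddChoose-+2^-shifted j k t′) (oddChoose-+2^ j k t′<d) ⟩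
  (oddChoose k (d + t′) xor oddChoose k t′) xor oddChoose k t′
    ≡⟨ xor-cancelʳ (oddChoose k (d + t′)) (oddChoose k t′) ⟩
  oddChoose k (d + t′)
    ≡⟨ cong (oddChoose k) d+t′≡t ⟩
  oddChoose k t ∎
  where
  open ≡-Reasoning
  d = 2 ^ j
  t′ = t ∸ d
  d+t′≡t : d + t′ ≡ t
  d+t′≡t = m+[n∸m]≡n (≮⇒≥ t≮d)
  t′<d : t′ < d
  t′<d = +-cancelˡ-< d t′ d (subst (_< d + d) (sym d+t′≡t) t<2d)

oddChoose-+2^-2^ : ∀ j k → oddChoose (k + 2 ^ j) (2 ^ j) ≡ not (oddChoose k (2 ^ j))
oddChoose-+2^-2^ j k = begin
  oddChoose (k + d) d              ≡⟨ cong (oddChoose (k + d)) (sym (+-identityʳ d)) ⟩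
  oddChoose (k + d) (d + 0)        ≡⟨ oddChoose-+2^-shifted j k 0 ⟩
  oddChoose k (d + 0) xor true     ≡⟨ cong (λ z → oddChoose k z xor true) (+-identityʳ d) ⟩
  oddChoose k d xor true           ≡⟨ xor-comm (oddChoose k d) true ⟩
  not (oddChoose k d)              ∎
  where
  open ≡-Reasoning
  d = 2 ^ j

step-induction : ∀ d .{{_ : NonZero d}} (P : ℕ → Set) →
                (∀ k → k < d → P k) → (∀ k → P k → P (k + d)) → ∀ k → P k
step-induction d P base step k = subst P (sym (m≡m%n+[m/n]*n k d)) (go (k / d))
  where
  go : ∀ q → P (k % d + q * d)
  go zero    = subst P (sym (+-identityʳ (k % d))) (base (k % d) (m%n<n k d))
  go (suc q) = subst P (trans (+-assoc (k % d) (q * d) d) (cong (λ x → k % d + x) (+-comm (q * d) d))) (step _ (go q))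

oddChoose-lucas : ∀ j {t} → t < 2 ^ j → ∀ k → oddChoose k (2 ^ j + t) ≡ oddChoose k (2 ^ j) ∧ oddChoose k t
oddChoose-lucas j {t} t<d = step-induction d {{m^n≢0 2 j}} _ base step
  where
  d = 2 ^ j
  base : ∀ k → k < d → oddChoose k (d + t) ≡ oddChoose k d ∧ oddChoose k t
  base k k<d rewrite oddChoose-< k<d = oddChoose-< (≤-trans k<d (m≤m+n d t))
  ∧-xor : ∀ x y → (x ∧ y) xor y ≡ not x ∧ y
  ∧-xor true  y = xor-same y
  ∧-xor false y = refl
  step : ∀ k → oddChoose k (d + t) ≡ oddChoose k d ∧ oddChoose k t →
         oddChoose (k + d) (d + t) ≡ oddChoose (k + d) d ∧ oddChoose (k + d) t
  step k ih rewrite oddChoose-+2^-shifted j k t | ih | oddChoose-+2^-2^ j k | oddChoose-+2^ j k t<d =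
    ∧-xor (oddChoose k d) (oddChoose k t)

-- The pair-sum operator

Bounded : ℕ → (ℕ → ℤ) → Set
Bounded M φ = ∀ k → ∣ φ k ∣ ≤ M

Periodic : ℕ → (ℕ → ℤ) → Set
Periodic d φ = ∀ k → φ (k + d) ≡ φ k

Antiperiodic : ℕ → (ℕ → ℤ) → Set
Antiperiodic d φ = ∀ k → φ (k + d) ≡ - φ k

pairSum : (ℕ → ℤ) → ℕ → ℤ
pairSum φ k = φ k ℤ.+ φ (suc k)

pairSum^-linear : ∀ i z φ ψ k →
  (pairSum ^ᵉ i) (λ n → φ n ℤ.+ z ℤ.* ψ n) k ≡ (pairSum ^ᵉ i) φ k ℤ.+ z ℤ.* (pairSum ^ᵉ i) ψ k
pairSum^-linear zero    z φ ψ k = refl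
pairSum^-linear (suc i) z φ ψ k =
  trans (cong₂ ℤ._+_ (pairSum^-linear i z φ ψ k) (pairSum^-linear i z φ ψ (suc k)))
        (regroup ((pairSum ^ᵉ i) φ k) ((pairSum ^ᵉ i) ψ k) ((pairSum ^ᵉ i) φ (suc k)) ((pairSum ^ᵉ i) ψ (suc k)) z)
  where
  regroup : ∀ a b c e z → (a ℤ.+ z ℤ.* b) ℤ.+ (c ℤ.+ z ℤ.* e) ≡ (a ℤ.+ c) ℤ.+ z ℤ.* (b ℤ.+ e)
  regroup = ℤ-Solver.solve-∀

pairSum^-antiperiodic : ∀ i {d φ} → Antiperiodic d φ → Antiperiodic d ((pairSum ^ᵉ i) φ)
pairSum^-antiperiodic zero    anti = anti
pairSum^-antiperiodic (suc i) {φ = φ} anti k =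
  trans (cong₂ ℤ._+_ (ih k) (ih (suc k))) (sym (ℤₚ.neg-distrib-+ ((pairSum ^ᵉ i) φ k) ((pairSum ^ᵉ i) φ (suc k))))
  where ih = pairSum^-antiperiodic i anti

pairSum-slack : ∀ {φ x P} → (∀ k → ∣ φ k ∣ + x ≤ P) → ∀ k → ∣ pairSum φ k ∣ + 2 * x ≤ 2 * P
pairSum-slack {φ} {x} {P} bound k = begin
  ∣ φ k ℤ.+ φ (suc k) ∣ + 2 * x           ≤⟨ +-monoˡ-≤ (2 * x) (ℤₚ.∣i+j∣≤∣i∣+∣j∣ (φ k) (φ (suc k))) ⟩
  (∣ φ k ∣ + ∣ φ (suc k) ∣) + 2 * x        ≡⟨ regroup ∣ φ k ∣ ∣ φ (suc k) ∣ x ⟩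
  (∣ φ k ∣ + x) + ((∣ φ (suc k) ∣ + x) + 0) ≤⟨ +-mono-≤ (bound k) (+-monoˡ-≤ 0 (bound (suc k))) ⟩
  2 * P                                    ∎
  where
  open ≤-Reasoning
  regroup : ∀ a b x → (a + b) + 2 * x ≡ (a + x) + ((b + x) + 0)
  regroup = ℕ-Solver.solve-∀

pairSum^-slack : ∀ r {φ x P} → (∀ k → ∣ φ k ∣ + x ≤ P) →
                 ∀ k → ∣ (pairSum ^ᵉ r) φ k ∣ + 2 ^ r * x ≤ 2 ^ r * P
pairSum^-slack zero {x = x} {P} bound k rewrite +-identityʳ x | +-identityʳ P = bound k
pairSum^-slack (suc r) {φ} {x} {P} bound k =
  subst₂ (λ y Q → ∣ (pairSum ^ᵉ suc r) φ k ∣ + y ≤ Q) (sym (*-assoc 2 (2 ^ r) x)) (sym (*-assoc 2 (2 ^ r) P))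
         (pairSum-slack {(pairSum ^ᵉ r) φ} (pairSum^-slack r bound) k)

pairSum^-bounded : ∀ r {φ M} → Bounded M φ → Bounded (2 ^ r * M) ((pairSum ^ᵉ r) φ)
pairSum^-bounded r bound k =
  m+n≤o⇒m≤o _ (pairSum^-slack r {x = 0} (λ k → subst (_≤ _) (sym (+-identityʳ _)) (bound k)) k)

-- (pairSum ^ᵉ n) φ k is Σᵢ (n choose i) φ (k + i); the weights of the interior terms
-- add up to 2ⁿ - 2.
pairSum^-interior : ∀ j {φ M} → Bounded M φ → ∀ k →
  ∣ (pairSum ^ᵉ suc j) φ k ℤ.- φ k ℤ.- φ (k + suc j) ∣ + 2 * M ≤ 2 ^ suc j * M
pairSum^-interior zero {φ} {M} bound k rewrite +-comm k 1 =
  ≤-reflexive (cong (λ z → ∣ z ∣ + 2 * M) (cancel (φ k) (φ (suc k))))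
  where
  cancel : ∀ x y → x ℤ.+ y ℤ.- x ℤ.- y ≡ 0ℤ
  cancel = ℤ-Solver.solve-∀
pairSum^-interior (suc j) {φ} {M} bound k rewrite +-suc k (suc j) = begin
  ∣ T₁ ℤ.+ T₂ ℤ.- φ k ℤ.- φ (suc m) ∣ + 2 * M
    ≡⟨ cong (λ z → ∣ z ∣ + 2 * M) (regroup T₁ T₂ (φ k) (φ (suc k)) (φ m) (φ (suc m))) ⟩
  ∣ E₁ ℤ.+ E₂ ℤ.+ (φ (suc k) ℤ.+ φ m) ∣ + 2 * M
    ≤⟨ +-monoˡ-≤ (2 * M) (ℤₚ.∣i+j∣≤∣i∣+∣j∣ (E₁ ℤ.+ E₂) (φ (suc k) ℤ.+ φ m)) ⟩
  (∣ E₁ ℤ.+ E₂ ∣ + ∣ φ (suc k) ℤ.+ φ m ∣) + 2 * M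
    ≤⟨ +-monoˡ-≤ (2 * M) (+-mono-≤ (ℤₚ.∣i+j∣≤∣i∣+∣j∣ E₁ E₂)
         (≤-trans (ℤₚ.∣i+j∣≤∣i∣+∣j∣ (φ (suc k)) (φ m)) (+-mono-≤ (bound (suc k)) (bound m)))) ⟩
  ((∣ E₁ ∣ + ∣ E₂ ∣) + (M + M)) + 2 * M
    ≡⟨ split ∣ E₁ ∣ ∣ E₂ ∣ M ⟩
  (∣ E₁ ∣ + 2 * M) + (∣ E₂ ∣ + 2 * M)
    ≤⟨ +-mono-≤ (pairSum^-interior j bound k) (pairSum^-interior j bound (suc k)) ⟩
  2 ^ suc j * M + 2 ^ suc j * M
    ≡⟨ double (2 ^ suc j) M ⟩
  2 ^ suc (suc j) * M ∎
  where
  open ≤-Reasoning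
  m = k + suc j
  T₁ = (pairSum ^ᵉ suc j) φ k
  T₂ = (pairSum ^ᵉ suc j) φ (suc k)
  E₁ = T₁ ℤ.- φ k ℤ.- φ m
  E₂ = T₂ ℤ.- φ (suc k) ℤ.- φ (suc m)
  regroup : ∀ t₁ t₂ a b c e →
            t₁ ℤ.+ t₂ ℤ.- a ℤ.- e ≡ (t₁ ℤ.- a ℤ.- c) ℤ.+ (t₂ ℤ.- b ℤ.- e) ℤ.+ (b ℤ.+ c)
  regroup = ℤ-Solver.solve-∀
  split : ∀ e₁ e₂ M → ((e₁ + e₂) + (M + M)) + 2 * M ≡ (e₁ + 2 * M) + (e₂ + 2 * M)
  split = ℕ-Solver.solve-∀
  double : ∀ x M → x * M + x * M ≡ (2 * x) * M
  double = ℕ-Solver.solve-∀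

-- After d steps antiperiodicity cancels the two end terms of pairSum^-interior.
pairSum^-antiperiodic-bound : ∀ {d H φ M} → 1 ≤ d → d ≤ H → Antiperiodic d φ → Bounded M φ →
  ∀ k → ∣ (pairSum ^ᵉ H) φ k ∣ + 2 * M ≤ 2 ^ H * M
pairSum^-antiperiodic-bound {d@(suc j)} {H} {φ} {M} _ d≤H anti bound k =
  subst (λ h → ∣ (pairSum ^ᵉ h) φ k ∣ + 2 * M ≤ 2 ^ h * M) (m∸n+n≡m d≤H) (begin
    ∣ (pairSum ^ᵉ (r + d)) φ k ∣ + 2 * M     ≡⟨ cong (λ f → ∣ f φ k ∣ + 2 * M) (^-homo pairSum r d) ⟩
    ∣ (pairSum ^ᵉ r) ψ k ∣ + 2 * M            ≤⟨ +-monoʳ-≤ _ (m≤n*m (2 * M) (2 ^ r) {{m^n≢0 2 r}}) ⟩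
    ∣ (pairSum ^ᵉ r) ψ k ∣ + 2 ^ r * (2 * M)  ≤⟨ pairSum^-slack r ψ-slack k ⟩
    2 ^ r * (2 ^ d * M)                       ≡⟨ sym (*-assoc (2 ^ r) (2 ^ d) M) ⟩
    2 ^ r * 2 ^ d * M                         ≡⟨ cong (_* M) (sym (^-distribˡ-+-* 2 r d)) ⟩
    2 ^ (r + d) * M                           ∎)
  where
  open ≤-Reasoning
  r = H ∸ d
  ψ = (pairSum ^ᵉ d) φ
  cancel : ∀ t p → t ℤ.- p ℤ.- (- p) ≡ t
  cancel = ℤ-Solver.solve-∀
  ψ-slack : ∀ k → ∣ ψ k ∣ + 2 * M ≤ 2 ^ d * M
  ψ-slack k = subst (λ z → ∣ z ∣ + 2 * M ≤ 2 ^ d * M)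
                    (trans (cong (λ z → ψ k ℤ.- φ k ℤ.- z) (anti k)) (cancel (ψ k) (φ k)))
                    (pairSum^-interior j bound k)

module Contraction (H : ℕ) (2≤H : 2 ≤ H) where

  B D : ℕ
  B = 2 ^ H
  D = B ∸ 2

  4≤B : 4 ≤ B
  4≤B = ^-monoʳ-≤ 2 2≤H

  D+2≡B : D + 2 ≡ B
  D+2≡B = m∸n+n≡m (≤-trans (s≤s (s≤s z≤n)) 4≤B)

  2≤D : 2 ≤ D
  2≤D = +-cancelʳ-≤ 2 2 D (subst (4 ≤_) (sym D+2≡B) 4≤B)

  -- A factor D = 2ᴴ - 2 per H applications of pairSum, where pairSum^-bounded only gives 2ᴴ.
  Contracting : ℕ → (ℕ → ℤ) → Set
  Contracting M φ = ∀ s → Bounded (M * D ^ s) ((pairSum ^ᵉ (s * H)) φ)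

  contracting-pairSum^ : ∀ {M φ} → Contracting M φ → Contracting (M * D) ((pairSum ^ᵉ H) φ)
  contracting-pairSum^ {M} {φ} contr s k =
    subst₂ (λ b ψ → ∣ ψ k ∣ ≤ b) (sym (*-assoc M D (D ^ s)))
      (trans (cong (λ h → (pairSum ^ᵉ h) φ) (+-comm H (s * H))) (cong (λ f → f φ) (^-homo pairSum (s * H) H)))
      (contr (suc s) k)

  contracting-linear : ∀ {M N φ ψ} z → Contracting M φ → Contracting N ψ →
                       Contracting (M + ∣ z ∣ * N) (λ k → φ k ℤ.+ z ℤ.* ψ k)
  contracting-linear {M} {N} {φ} {ψ} z cφ cψ s k = begin
    ∣ (pairSum ^ᵉ (s * H)) (λ n → φ n ℤ.+ z ℤ.* ψ n) k ∣
      ≡⟨ cong ∣_∣ (pairSum^-linear (s * H) z φ ψ k) ⟩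
    ∣ (pairSum ^ᵉ (s * H)) φ k ℤ.+ z ℤ.* (pairSum ^ᵉ (s * H)) ψ k ∣
      ≤⟨ ℤₚ.∣i+j∣≤∣i∣+∣j∣ ((pairSum ^ᵉ (s * H)) φ k) (z ℤ.* (pairSum ^ᵉ (s * H)) ψ k) ⟩
    ∣ (pairSum ^ᵉ (s * H)) φ k ∣ + ∣ z ℤ.* (pairSum ^ᵉ (s * H)) ψ k ∣
      ≡⟨ cong (∣ (pairSum ^ᵉ (s * H)) φ k ∣ +_) (ℤₚ.∣i*j∣≡∣i∣*∣j∣ z _) ⟩
    ∣ (pairSum ^ᵉ (s * H)) φ k ∣ + ∣ z ∣ * ∣ (pairSum ^ᵉ (s * H)) ψ k ∣
      ≤⟨ +-mono-≤ (cφ s k) (*-monoʳ-≤ ∣ z ∣ (cψ s k)) ⟩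
    M * D ^ s + ∣ z ∣ * (N * D ^ s)
      ≡⟨ regroup M ∣ z ∣ N (D ^ s) ⟩
    (M + ∣ z ∣ * N) * D ^ s ∎
    where
    open ≤-Reasoning
    regroup : ∀ M z N x → M * x + z * (N * x) ≡ (M + z * N) * x
    regroup = ℕ-Solver.solve-∀

  antiperiodic⇒contracting : ∀ {d M φ} → 1 ≤ d → d ≤ H → Antiperiodic d φ → Bounded M φ → Contracting M φ
  antiperiodic⇒contracting {M = M} {φ} _ _ _ bound zero k = subst (∣ φ k ∣ ≤_) (sym (*-identityʳ M)) (bound k)
  antiperiodic⇒contracting {M = M} {φ} 1≤d d≤H anti bound (suc s) k = begin
    ∣ (pairSum ^ᵉ (H + s * H)) φ k ∣  ≡⟨ cong (λ f → ∣ f φ k ∣) (^-homo pairSum H (s * H)) ⟩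
    ∣ (pairSum ^ᵉ H) ψ k ∣              ≤⟨ +-cancelʳ-≤ (2 * M′) _ _ (begin
      ∣ (pairSum ^ᵉ H) ψ k ∣ + 2 * M′     ≤⟨ pairSum^-antiperiodic-bound 1≤d d≤H
                                                (pairSum^-antiperiodic (s * H) anti)
                                                (antiperiodic⇒contracting 1≤d d≤H anti bound s) k ⟩
      B * M′                             ≡⟨ cong (_* M′) (sym D+2≡B) ⟩
      (D + 2) * M′                       ≡⟨ *-distribʳ-+ M′ D 2 ⟩
      D * M′ + 2 * M′                    ∎) ⟩
    D * (M * D ^ s)                    ≡⟨ regroup D M (D ^ s) ⟩
    M * D ^ suc s                      ∎
    where
    open ≤-Reasoning
    ψ = (pairSum ^ᵉ (s * H)) φ
    M′ = M * D ^ s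
    regroup : ∀ D M x → D * (M * x) ≡ M * (D * x)
    regroup = ℕ-Solver.solve-∀

-- Growth rates

*-distribʳ-^ : ∀ x y n → (x * y) ^ n ≡ x ^ n * y ^ n
*-distribʳ-^ x y zero    = refl
*-distribʳ-^ x y (suc n) rewrite *-distribʳ-^ x y n = regroup x y (x ^ n) (y ^ n)
  where
  regroup : ∀ x y u v → x * y * (u * v) ≡ x * u * (y * v)
  regroup = ℕ-Solver.solve-∀

^-swap : ∀ x m n → (x ^ m) ^ n ≡ (x ^ n) ^ m
^-swap x m n = trans (^-*-assoc x m n) (trans (cong (x ^_) (*-comm m n)) (sym (^-*-assoc x n m)))

1≤^ : ∀ {x} → 1 ≤ x → ∀ n → 1 ≤ x ^ n
1≤^ 1≤x zero    = ≤-refl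
1≤^ 1≤x (suc n) = *-mono-≤ 1≤x (1≤^ 1≤x n)

n≤n^p : ∀ {n p} → 1 ≤ n → 1 ≤ p → n ≤ n ^ p
n≤n^p {n} {suc p} 1≤n _ = subst (_≤ n ^ suc p) (*-identityʳ n) (*-monoʳ-≤ n (1≤^ 1≤n p))

bernoulli : ∀ D q → D ^ q * (D + 2 * q) ≤ D * (D + 2) ^ q
bernoulli D zero    = ≤-reflexive (trans (+-identityʳ (D + 0)) (trans (+-identityʳ D) (sym (*-identityʳ D))))
bernoulli D (suc q) = begin
  D * D ^ q * (D + 2 * suc q)            ≡⟨ regroup₁ D (D ^ q) q ⟩
  D ^ q * (D * (D + 2 * suc q))          ≤⟨ *-monoʳ-≤ (D ^ q) (m≤m+n _ (4 * q)) ⟩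
  D ^ q * (D * (D + 2 * suc q) + 4 * q)  ≡⟨ regroup₂ D (D ^ q) q ⟩
  (D + 2) * (D ^ q * (D + 2 * q))        ≤⟨ *-monoʳ-≤ (D + 2) (bernoulli D q) ⟩
  (D + 2) * (D * (D + 2) ^ q)            ≡⟨ regroup₃ D ((D + 2) ^ q) ⟩
  D * ((D + 2) * (D + 2) ^ q)            ∎
  where
  open ≤-Reasoning
  regroup₁ : ∀ D x q → D * x * (D + 2 * suc q) ≡ x * (D * (D + 2 * suc q))
  regroup₁ = ℕ-Solver.solve-∀
  regroup₂ : ∀ D x q → x * (D * (D + 2 * suc q) + 4 * q) ≡ (D + 2) * (x * (D + 2 * q))
  regroup₂ = ℕ-Solver.solve-∀
  regroup₃ : ∀ D y → (D + 2) * (D * y) ≡ D * ((D + 2) * y)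
  regroup₃ = ℕ-Solver.solve-∀

-- Bernoulli's inequality with Q = D (D + 2).
power-gap : ∀ {D} → 1 ≤ D → ∃[ Q ] 1 ≤ Q × D ^ Q * (D + 2) ≤ (D + 2) ^ Q
power-gap {D@(suc _)} _ = Q , s≤s z≤n , *-cancelˡ-≤ D (begin
  D * (D ^ Q * (D + 2))  ≡⟨ regroup D (D ^ Q) ⟩
  D ^ Q * Q              ≤⟨ *-monoʳ-≤ (D ^ Q) (≤-trans (m≤n+m Q D) (+-monoʳ-≤ D (m≤n*m Q 2))) ⟩
  D ^ Q * (D + 2 * Q)    ≤⟨ bernoulli D Q ⟩
  D * (D + 2) ^ Q        ∎)
  where
  open ≤-Reasoning
  Q = D * (D + 2)
  regroup : ∀ D x → D * (x * (D + 2)) ≡ x * (D * (D + 2))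
  regroup = ℕ-Solver.solve-∀

log-bracket : ∀ {B} → 2 ≤ B → ∀ {N} → 1 ≤ N → ∃[ t ] B ^ t ≤ N × N < B ^ suc t
log-bracket {B} 2≤B {suc zero}    _ = 0 , ≤-refl , subst (1 <_) (sym (*-identityʳ B)) 2≤B
log-bracket {B} 2≤B {suc (suc n)} _ with log-bracket 2≤B (s≤s z≤n)
... | t , B^t≤1+n , 1+n<B^[1+t] with suc (suc n) <? B ^ suc t
...   | yes 2+n<B^[1+t] = t , m≤n⇒m≤1+n B^t≤1+n , 2+n<B^[1+t]
...   | no  2+n≮B^[1+t] = suc t , ≤-reflexive (sym 2+n≡B^[1+t]) ,
          subst₂ _<_ (sym 2+n≡B^[1+t]) (*-comm (B ^ suc t) B) (m<m*n (B ^ suc t) B {{B^[1+t]≢0}} 2≤B)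
  where
  2+n≡B^[1+t] : suc (suc n) ≡ B ^ suc t
  2+n≡B^[1+t] = ≤-antisym 1+n<B^[1+t] (≮⇒≥ 2+n≮B^[1+t])
  B^[1+t]≢0 : NonZero (B ^ suc t)
  B^[1+t]≢0 = m^n≢0 B (suc t) {{>-nonZero (≤-trans (s≤s z≤n) 2≤B)}}

top-bit : ∀ {ℓ} → 1 ≤ ℓ → ∃[ j ] ∃[ t ] ℓ ≡ 2 ^ j + t × t < 2 ^ j
top-bit {ℓ} 1≤ℓ with log-bracket ≤-refl 1≤ℓ
... | j , 2^j≤ℓ , ℓ<2^[1+j] = j , ℓ ∸ 2 ^ j , sym ℓ≡2^j+t , +-cancelˡ-< (2 ^ j) (ℓ ∸ 2 ^ j) (2 ^ j)
        (subst₂ _<_ (sym ℓ≡2^j+t) (2^[1+j]≡2^j+2^j j) ℓ<2^[1+j])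
  where
  ℓ≡2^j+t : 2 ^ j + (ℓ ∸ 2 ^ j) ≡ ℓ
  ℓ≡2^j+t = m+[n∸m]≡n 2^j≤ℓ

-- PropertyP w unfolds to PowerSaving (λ N → ∣ S w N ∣).
PowerSaving : (ℕ → ℕ) → Set
PowerSaving X = ∃[ p ] ∃[ q ] ∃[ C ] ∃[ N₀ ] (0 < p × 0 < q × (∀ N → N₀ ≤ N → X N ^ q * N ^ p ≤ C * N ^ q))

powerSaving-mono : ∀ {X Y} → (∀ N → X N ≤ Y N) → PowerSaving Y → PowerSaving X
powerSaving-mono X≤Y (p , q , C , N₀ , 0<p , 0<q , bound) =
  p , q , C , N₀ , 0<p , 0<q , λ N N₀≤N → ≤-trans (*-monoˡ-≤ (N ^ p) (^-monoˡ-≤ q (X≤Y N))) (bound N N₀≤N)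

geometric⇒powerSaving : ∀ {D K X} → 1 ≤ D → (∀ t N → N < (D + 2) ^ t → X N ≤ K * D ^ t) → PowerSaving X
geometric⇒powerSaving {D} {K} {X} 1≤D geometric with power-gap 1≤D
... | Q , 1≤Q , gap = 1 , Q , C , 1 , s≤s z≤n , 1≤Q , bound
  where
  B = D + 2
  C = (K * D) ^ Q * B
  bound : ∀ N → 1 ≤ N → X N ^ Q * N ^ 1 ≤ C * N ^ Q
  bound N 1≤N with log-bracket (m≤n+m 2 D) 1≤N
  ... | t , B^t≤N , N<B^[1+t] = begin
    X N ^ Q * N ^ 1                     ≤⟨ *-mono-≤ (^-monoˡ-≤ Q (geometric (suc t) N N<B^[1+t])) (≤-reflexive (*-identityʳ N)) ⟩
    (K * D ^ suc t) ^ Q * N              ≡⟨ cong (λ y → y ^ Q * N) (sym (*-assoc K D (D ^ t))) ⟩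
    (K * D * D ^ t) ^ Q * N              ≡⟨ cong (_* N) (trans (*-distribʳ-^ (K * D) (D ^ t) Q) (cong ((K * D) ^ Q *_) (^-swap D t Q))) ⟩
    (K * D) ^ Q * (D ^ Q) ^ t * N        ≤⟨ *-monoʳ-≤ ((K * D) ^ Q * (D ^ Q) ^ t) (<⇒≤ N<B^[1+t]) ⟩
    (K * D) ^ Q * (D ^ Q) ^ t * (B * B ^ t) ≡⟨ regroup ((K * D) ^ Q) ((D ^ Q) ^ t) B (B ^ t) ⟩
    C * ((D ^ Q) ^ t * B ^ t)            ≡⟨ cong (C *_) (sym (*-distribʳ-^ (D ^ Q) B t)) ⟩
    C * (D ^ Q * B) ^ t                  ≤⟨ *-monoʳ-≤ C (^-monoˡ-≤ t gap) ⟩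
    C * (B ^ Q) ^ t                      ≡⟨ cong (C *_) (^-swap B Q t) ⟩
    C * (B ^ t) ^ Q                      ≤⟨ *-monoʳ-≤ C (^-monoˡ-≤ Q B^t≤N) ⟩
    C * N ^ Q                            ∎
    where
    open ≤-Reasoning
    regroup : ∀ x y b u → x * y * (b * u) ≡ x * b * (y * u)
    regroup = ℕ-Solver.solve-∀

powerSaving⇒sublinear : ∀ {X} → PowerSaving X → ∀ m → ∃[ N₀ ] ∀ N → N₀ ≤ N → m * X N ≤ N
powerSaving⇒sublinear {X} (p , q , C , N₀ , 0<p , 0<q , bound) m = N₀ + suc (m ^ q * C) , sublinear
  where
  sublinear : ∀ N → N₀ + suc (m ^ q * C) ≤ N → m * X N ≤ N
  sublinear N N₁≤N with m * X N ≤? N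
  ... | yes mX≤N = mX≤N
  ... | no  mX≰N = contradiction N≤m^qC (<⇒≱ m^qC<N)
    where
    m^qC<N : m ^ q * C < N
    m^qC<N = ≤-trans (m≤n+m _ N₀) N₁≤N
    1≤N : 1 ≤ N
    1≤N = ≤-trans (s≤s z≤n) m^qC<N
    N≤m^qC : N ≤ m ^ q * C
    N≤m^qC = ≤-trans (n≤n^p 1≤N 0<p) (*-cancelʳ-≤ (N ^ p) (m ^ q * C) (N ^ q) {{m^n≢0 N q {{>-nonZero 1≤N}}}} (begin
      N ^ p * N ^ q              ≡⟨ *-comm (N ^ p) (N ^ q) ⟩
      N ^ q * N ^ p              ≤⟨ *-monoˡ-≤ (N ^ p) (^-monoˡ-≤ q (<⇒≤ (≰⇒> mX≰N))) ⟩
      (m * X N) ^ q * N ^ p      ≡⟨ trans (cong (_* N ^ p) (*-distribʳ-^ m (X N) q)) (*-assoc (m ^ q) _ _) ⟩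
      m ^ q * (X N ^ q * N ^ p)  ≤⟨ *-monoʳ-≤ (m ^ q) (bound N (≤-trans (m≤m+n N₀ _) N₁≤N)) ⟩
      m ^ q * (C * N ^ q)        ≡⟨ sym (*-assoc (m ^ q) C (N ^ q)) ⟩
      m ^ q * C * N ^ q          ∎))
      where open ≤-Reasoning

-- Decomposing the binomial signs

binomialSign : ℕ → ℕ → ℤ
binomialSign t k = signOf (oddChoose k t)

binomialSign-bounded : ∀ t → Bounded 1 (binomialSign t)
binomialSign-bounded t k with oddChoose k t
... | true  = ≤-refl
... | false = ≤-refl

binomialSign-antiperiodic : ∀ j → Antiperiodic (2 ^ j) (binomialSign (2 ^ j))
binomialSign-antiperiodic j k = trans (cong signOf (oddChoose-+2^-2^ j k)) (signOf-not (oddChoose k (2 ^ j)))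

binomialSign-periodic : ∀ j {t} → t < 2 ^ j → Periodic (2 ^ j) (binomialSign t)
binomialSign-periodic j t<2^j k = cong signOf (oddChoose-+2^ j k t<2^j)

antiperiodic-*-periodic : ∀ {d φ ψ} → Antiperiodic d φ → Periodic d ψ → Antiperiodic d (λ k → φ k ℤ.* ψ k)
antiperiodic-*-periodic {φ = φ} {ψ} anti per k =
  trans (cong₂ ℤ._*_ (anti k) (per k)) (sym (ℤₚ.neg-distribˡ-* (φ k) (ψ k)))

lucasCorrection : ℕ → ℕ → ℕ → ℤ
lucasCorrection j t k = binomialSign (2 ^ j) k ℤ.* (1ℤ ℤ.- binomialSign t k)

lucasCorrection-antiperiodic : ∀ j {t} → t < 2 ^ j → Antiperiodic (2 ^ j) (lucasCorrection j t)
lucasCorrection-antiperiodic j t<2^j = antiperiodic-*-periodic (binomialSign-antiperiodic j)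
  (λ k → cong (λ z → 1ℤ ℤ.- z) (binomialSign-periodic j t<2^j k))

lucasCorrection-bounded : ∀ j t → Bounded 2 (lucasCorrection j t)
lucasCorrection-bounded j t k with oddChoose k (2 ^ j) | oddChoose k t
... | true  | true  = ≤-refl
... | true  | false = z≤n
... | false | true  = ≤-refl
... | false | false = z≤n

binomialSign-lucas : ∀ j {t} → t < 2 ^ j → ∀ k →
  binomialSign (2 ^ j + t) k ℤ.+ binomialSign (2 ^ j + t) k ≡ 1ℤ ℤ.+ binomialSign t k ℤ.+ lucasCorrection j t k
binomialSign-lucas j {t} t<2^j k rewrite oddChoose-lucas j t<2^j k = signs (oddChoose k (2 ^ j)) (oddChoose k t)
  where
  signs : ∀ x y → signOf (x ∧ y) ℤ.+ signOf (x ∧ y) ≡ 1ℤ ℤ.+ signOf y ℤ.+ signOf x ℤ.* (1ℤ ℤ.- signOf y)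
  signs true  true  = refl
  signs true  false = refl
  signs false true  = refl
  signs false false = refl

module AffineDecomposition (H : ℕ) (2≤H : 2 ≤ H) where
  open Contraction H 2≤H

  AffinelyContracting : ℕ → (ℕ → ℤ) → Set
  AffinelyContracting c φ =
    ∃[ σ ] ∃[ M ] ∃[ ψ ] (1 ≤ σ × Contracting M ψ × (∀ k → ℤ.+ σ ℤ.* φ k ≡ ℤ.+ c ℤ.+ ψ k))

  binomialSign-2^-affine : ∀ j → 2 ^ j ≤ H → AffinelyContracting 0 (binomialSign (2 ^ j))
  binomialSign-2^-affine j 2^j≤H = 1 , 1 , binomialSign (2 ^ j) , ≤-refl ,
    antiperiodic⇒contracting (m^n>0 2 j) 2^j≤H (binomialSign-antiperiodic j) (binomialSign-bounded (2 ^ j)) ,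
    λ k → trans (ℤₚ.*-identityˡ (binomialSign (2 ^ j) k)) (sym (ℤₚ.+-identityˡ (binomialSign (2 ^ j) k)))

  binomialSign-affine-step : ∀ j {t c} → t < 2 ^ j → 2 ^ j ≤ H → AffinelyContracting c (binomialSign t) →
                             ∃[ c′ ] 1 ≤ c′ × AffinelyContracting c′ (binomialSign (2 ^ j + t))
  binomialSign-affine-step j {t} {c} t<2^j 2^j≤H (σ , M , ψ , 1≤σ , contr , decomp) =
    σ + c , ≤-trans 1≤σ (m≤m+n σ c) , σ + σ , M + σ * 2 , ψ′ , ≤-trans 1≤σ (m≤m+n σ σ) ,
    contracting-linear {M} {2} (ℤ.+ σ) contr
      (antiperiodic⇒contracting (m^n>0 2 j) 2^j≤H (lucasCorrection-antiperiodic j t<2^j) (lucasCorrection-bounded j t)) ,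
    decomp′
    where
    σℤ = ℤ.+ σ
    f = binomialSign (2 ^ j + t)
    g = binomialSign t
    χ = lucasCorrection j t
    ψ′ : ℕ → ℤ
    ψ′ k = ψ k ℤ.+ σℤ ℤ.* χ k
    decomp′ : ∀ k → ℤ.+ (σ + σ) ℤ.* f k ≡ ℤ.+ (σ + c) ℤ.+ ψ′ k
    decomp′ k = begin
      ℤ.+ (σ + σ) ℤ.* f k                       ≡⟨ cong (ℤ._* f k) (ℤₚ.pos-+ σ σ) ⟩
      (σℤ ℤ.+ σℤ) ℤ.* f k                       ≡⟨ ℤₚ.*-distribʳ-+ (f k) σℤ σℤ ⟩
      σℤ ℤ.* f k ℤ.+ σℤ ℤ.* f k                 ≡⟨ sym (ℤₚ.*-distribˡ-+ σℤ (f k) (f k)) ⟩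
      σℤ ℤ.* (f k ℤ.+ f k)                      ≡⟨ cong (σℤ ℤ.*_) (binomialSign-lucas j t<2^j k) ⟩
      σℤ ℤ.* (1ℤ ℤ.+ g k ℤ.+ χ k)               ≡⟨ expand σℤ (g k) (χ k) ⟩
      σℤ ℤ.+ σℤ ℤ.* g k ℤ.+ σℤ ℤ.* χ k          ≡⟨ cong (λ z → σℤ ℤ.+ z ℤ.+ σℤ ℤ.* χ k) (decomp k) ⟩
      σℤ ℤ.+ (ℤ.+ c ℤ.+ ψ k) ℤ.+ σℤ ℤ.* χ k     ≡⟨ regroup σℤ (ℤ.+ c) (ψ k) (σℤ ℤ.* χ k) ⟩
      σℤ ℤ.+ ℤ.+ c ℤ.+ ψ′ k                     ≡⟨ cong (ℤ._+ ψ′ k) (sym (ℤₚ.pos-+ σ c)) ⟩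
      ℤ.+ (σ + c) ℤ.+ ψ′ k                      ∎
      where
      open ≡-Reasoning
      expand : ∀ s g χ → s ℤ.* (1ℤ ℤ.+ g ℤ.+ χ) ≡ s ℤ.+ s ℤ.* g ℤ.+ s ℤ.* χ
      expand = ℤ-Solver.solve-∀
      regroup : ∀ s c ψ x → s ℤ.+ (c ℤ.+ ψ) ℤ.+ x ≡ (s ℤ.+ c) ℤ.+ (ψ ℤ.+ x)
      regroup = ℤ-Solver.solve-∀

  binomialSign-affine : ∀ ℓ → 1 ≤ ℓ → ℓ ≤ H → ∃[ c ] AffinelyContracting c (binomialSign ℓ)
  binomialSign-affine = <-rec _ affine
    where
    affine : ∀ ℓ → (∀ {t} → t < ℓ → 1 ≤ t → t ≤ H → ∃[ c ] AffinelyContracting c (binomialSign t)) →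
             1 ≤ ℓ → ℓ ≤ H → ∃[ c ] AffinelyContracting c (binomialSign ℓ)
    affine ℓ rec 1≤ℓ ℓ≤H with top-bit 1≤ℓ
    ... | j , zero , refl , _ = 0 , subst (λ h → AffinelyContracting 0 (binomialSign h)) (sym (+-identityʳ (2 ^ j)))
                                          (binomialSign-2^-affine j (≤-trans (m≤m+n (2 ^ j) 0) ℓ≤H))
    ... | j , t@(suc _) , refl , t<2^j with rec (m<n+m t (m^n>0 2 j)) (s≤s z≤n) (≤-trans (m≤n+m t (2 ^ j)) ℓ≤H)
    ...   | _ , affine-t with binomialSign-affine-step j t<2^j (≤-trans (m≤m+n (2 ^ j) t) ℓ≤H) affine-t
    ...     | c′ , _ , affine-ℓ = c′ , affine-ℓ

-- Sums over digit counts

even-or-odd : ∀ N → ∃[ n ] (N ≡ n + n ⊎ N ≡ suc (n + n))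
even-or-odd zero    = 0 , inj₁ refl
even-or-odd (suc N) with even-or-odd N
... | n , inj₁ refl = n , inj₂ refl
... | n , inj₂ refl = suc n , inj₁ (cong suc (sym (+-suc n n)))

n+n<2*X⇒n<X : ∀ {n X} → n + n < 2 * X → n < X
n+n<2*X⇒n<X {n} {X} p = *-cancelˡ-< 2 n X (subst (_< 2 * X) (cong (n +_) (sym (+-identityʳ n))) p)

module WeightSums (a : Fin 2) where

  weight : ℕ → ℕ
  weight n = count a (bin n)

  -- weightSum φ N = Σ_{1 ≤ n ≤ N} φ (weight n); the term n = 0 is left out, as bin 0 = 0
  -- does not follow bin-double.
  weightSum : (ℕ → ℤ) → ℕ → ℤ
  weightSum φ zero    = 0ℤ
  weightSum φ (suc N) = weightSum φ N ℤ.+ φ (weight (suc N))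

  pairSum-weight : ∀ φ n .{{_ : NonZero n}} → φ (weight (n + n)) ℤ.+ φ (weight (suc (n + n))) ≡ pairSum φ (weight n)
  pairSum-weight φ n = begin
    φ (weight (n + n)) ℤ.+ φ (weight (suc (n + n)))
      ≡⟨ cong₂ (λ u v → φ (count a u) ℤ.+ φ (count a v)) (bin-double n) (bin-double+1 n) ⟩
    φ (count a (bin n ++ [ F.zero ])) ℤ.+ φ (count a (bin n ++ [ F.suc F.zero ]))
      ≡⟨ cong₂ (λ x y → φ x ℤ.+ φ y) (count-++ a (bin n) F.zero) (count-++ a (bin n) (F.suc F.zero)) ⟩
    φ (weight n + count a [ F.zero ]) ℤ.+ φ (weight n + count a [ F.suc F.zero ])
      ≡⟨ new-digit a (weight n) ⟩
    pairSum φ (weight n) ∎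
    where
    open ≡-Reasoning
    new-digit : ∀ a w → φ (w + count a [ F.zero ]) ℤ.+ φ (w + count a [ F.suc F.zero ]) ≡ φ w ℤ.+ φ (suc w)
    new-digit F.zero w rewrite +-identityʳ w | +-comm w 1 = ℤₚ.+-comm (φ (suc w)) (φ w)
    new-digit (F.suc F.zero) w rewrite +-identityʳ w | +-comm w 1 = refl

  weightSum-halving : ∀ φ N → weightSum φ (suc (N + N)) ≡ φ (weight 1) ℤ.+ weightSum (pairSum φ) N
  weightSum-halving φ zero    = ℤₚ.+-comm 0ℤ (φ (weight 1))
  weightSum-halving φ (suc n) = begin
    weightSum φ (n + suc n) ℤ.+ φ (weight (suc n + suc n)) ℤ.+ φ (weight (suc (suc n + suc n)))
      ≡⟨ ℤₚ.+-assoc (weightSum φ (n + suc n)) _ _ ⟩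
    weightSum φ (n + suc n) ℤ.+ (φ (weight (suc n + suc n)) ℤ.+ φ (weight (suc (suc n + suc n))))
      ≡⟨ cong₂ ℤ._+_ (trans (cong (weightSum φ) (+-suc n n)) (weightSum-halving φ n)) (pairSum-weight φ (suc n)) ⟩
    φ (weight 1) ℤ.+ weightSum (pairSum φ) n ℤ.+ pairSum φ (weight (suc n))
      ≡⟨ ℤₚ.+-assoc (φ (weight 1)) (weightSum (pairSum φ) n) _ ⟩
    φ (weight 1) ℤ.+ weightSum (pairSum φ) (suc n) ∎
    where open ≡-Reasoning

  weightSum-halve : ∀ {φ M} → Bounded M φ → ∀ X N → N < 2 * X →
                    ∃[ N′ ] N′ < X × ∣ weightSum φ N ∣ ≤ ∣ weightSum (pairSum φ) N′ ∣ + 2 * M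
  weightSum-halve {φ} {M} bound X N N<2X with even-or-odd N
  ... | n , inj₂ refl = n , n+n<2*X⇒n<X (<⇒≤ N<2X) , (begin
    ∣ weightSum φ (suc (n + n)) ∣                   ≡⟨ cong ∣_∣ (weightSum-halving φ n) ⟩
    ∣ φ (weight 1) ℤ.+ weightSum (pairSum φ) n ∣     ≤⟨ ℤₚ.∣i+j∣≤∣i∣+∣j∣ (φ (weight 1)) _ ⟩
    ∣ φ (weight 1) ∣ + ∣ weightSum (pairSum φ) n ∣   ≤⟨ +-monoˡ-≤ _ (≤-trans (bound _) (m≤m+n M (M + 0))) ⟩
    2 * M + ∣ weightSum (pairSum φ) n ∣              ≡⟨ +-comm (2 * M) _ ⟩
    ∣ weightSum (pairSum φ) n ∣ + 2 * M              ∎)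
    where open ≤-Reasoning
  ... | n , inj₁ refl = n , n+n<2*X⇒n<X N<2X , (begin
    ∣ weightSum φ (n + n) ∣
      ≡⟨ cong ∣_∣ (drop-last (weightSum φ (n + n)) (φ (weight (suc (n + n))))) ⟩
    ∣ weightSum φ (suc (n + n)) ℤ.- φ (weight (suc (n + n))) ∣
      ≡⟨ cong (λ z → ∣ z ℤ.- φ (weight (suc (n + n))) ∣) (weightSum-halving φ n) ⟩
    ∣ φ (weight 1) ℤ.+ weightSum (pairSum φ) n ℤ.- φ (weight (suc (n + n))) ∣
      ≤⟨ ℤₚ.∣i-j∣≤∣i∣+∣j∣ (φ (weight 1) ℤ.+ weightSum (pairSum φ) n) _ ⟩
    ∣ φ (weight 1) ℤ.+ weightSum (pairSum φ) n ∣ + ∣ φ (weight (suc (n + n))) ∣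
      ≤⟨ +-mono-≤ (ℤₚ.∣i+j∣≤∣i∣+∣j∣ (φ (weight 1)) _) (bound _) ⟩
    (∣ φ (weight 1) ∣ + ∣ weightSum (pairSum φ) n ∣) + M
      ≤⟨ +-monoˡ-≤ M (+-monoˡ-≤ _ (bound _)) ⟩
    (M + ∣ weightSum (pairSum φ) n ∣) + M
      ≡⟨ regroup M ∣ weightSum (pairSum φ) n ∣ ⟩
    ∣ weightSum (pairSum φ) n ∣ + 2 * M ∎)
    where
    open ≤-Reasoning
    drop-last : ∀ x y → x ≡ x ℤ.+ y ℤ.- y
    drop-last = ℤ-Solver.solve-∀
    regroup : ∀ M v → (M + v) + M ≡ v + 2 * M
    regroup = ℕ-Solver.solve-∀

  weightSum-descend : ∀ i {φ M} → Bounded M φ → ∀ X N → N < 2 ^ i * X →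
    ∃[ N′ ] N′ < X × ∣ weightSum φ N ∣ + 2 * M ≤ ∣ weightSum ((pairSum ^ᵉ i) φ) N′ ∣ + 2 ^ suc i * M
  weightSum-descend zero    bound X N N<X = N , subst (N <_) (+-identityʳ X) N<X , ≤-refl
  weightSum-descend (suc i) {φ} {M} bound X N N<2^[1+i]X
    with weightSum-descend i bound (2 * X) N
           (subst (N <_) (trans (cong (_* X) (*-comm 2 (2 ^ i))) (*-assoc (2 ^ i) 2 X)) N<2^[1+i]X)
  ... | N″ , N″<2X , descent with weightSum-halve (pairSum^-bounded i bound) X N″ N″<2X
  ...   | N′ , N′<X , halving = N′ , N′<X , (begin
    ∣ weightSum φ N ∣ + 2 * M
      ≤⟨ descent ⟩
    ∣ weightSum ((pairSum ^ᵉ i) φ) N″ ∣ + 2 ^ suc i * M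
      ≤⟨ +-monoˡ-≤ _ halving ⟩
    ∣ weightSum ((pairSum ^ᵉ suc i) φ) N′ ∣ + 2 * (2 ^ i * M) + 2 ^ suc i * M
      ≡⟨ regroup ∣ weightSum ((pairSum ^ᵉ suc i) φ) N′ ∣ (2 ^ i) M ⟩
    ∣ weightSum ((pairSum ^ᵉ suc i) φ) N′ ∣ + 2 ^ suc (suc i) * M ∎)
    where
    open ≤-Reasoning
    regroup : ∀ v x M → v + 2 * (x * M) + (2 * x) * M ≡ v + (2 * (2 * x)) * M
    regroup = ℕ-Solver.solve-∀

  weightSum-affine : ∀ {σ c φ ψ} → (∀ k → ℤ.+ σ ℤ.* φ k ≡ ℤ.+ c ℤ.+ ψ k) →
                     ∀ N → ℤ.+ σ ℤ.* weightSum φ N ≡ ℤ.+ c ℤ.* ℤ.+ N ℤ.+ weightSum ψ N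
  weightSum-affine {σ} {c} _ zero = zeros (ℤ.+ σ) (ℤ.+ c)
    where
    zeros : ∀ s c → s ℤ.* 0ℤ ≡ c ℤ.* 0ℤ ℤ.+ 0ℤ
    zeros = ℤ-Solver.solve-∀
  weightSum-affine {σ} {c} {φ} {ψ} decomp (suc N) = begin
    σℤ ℤ.* (weightSum φ N ℤ.+ φ (weight (suc N)))
      ≡⟨ ℤₚ.*-distribˡ-+ σℤ (weightSum φ N) (φ (weight (suc N))) ⟩
    σℤ ℤ.* weightSum φ N ℤ.+ σℤ ℤ.* φ (weight (suc N))
      ≡⟨ cong₂ ℤ._+_ (weightSum-affine {σ} {c} {φ} {ψ} decomp N) (decomp (weight (suc N))) ⟩
    (cℤ ℤ.* ℤ.+ N ℤ.+ weightSum ψ N) ℤ.+ (cℤ ℤ.+ ψ (weight (suc N)))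
      ≡⟨ regroup cℤ (ℤ.+ N) (weightSum ψ N) (ψ (weight (suc N))) ⟩
    cℤ ℤ.* (1ℤ ℤ.+ ℤ.+ N) ℤ.+ (weightSum ψ N ℤ.+ ψ (weight (suc N))) ∎
    where
    open ≡-Reasoning
    σℤ = ℤ.+ σ
    cℤ = ℤ.+ c
    regroup : ∀ c n v x → (c ℤ.* n ℤ.+ v) ℤ.+ (c ℤ.+ x) ≡ c ℤ.* (1ℤ ℤ.+ n) ℤ.+ (v ℤ.+ x)
    regroup = ℤ-Solver.solve-∀

  module _ (H : ℕ) (2≤H : 2 ≤ H) where
    open Contraction H 2≤H

    -- The slack 2BM on the left absorbs the error of each block of H halvings, because D ≥ 2.
    weightSum-geometric : ∀ t {M φ} → Contracting M φ → ∀ N → N < B ^ t →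
                          ∣ weightSum φ N ∣ + 2 * (B * M) ≤ 2 * (B * M) * D ^ t
    weightSum-geometric zero    {M} _ zero    _        = ≤-reflexive (sym (*-identityʳ (2 * (B * M))))
    weightSum-geometric zero        _ (suc N) (s≤s ())
    weightSum-geometric (suc t) {M} {φ} contr N N<B^[1+t]
      with weightSum-descend H (subst (λ b → Bounded b φ) (*-identityʳ M) (contr 0)) (B ^ t) N N<B^[1+t]
    ... | N′ , N′<B^t , descent = begin
      ∣ weightSum φ N ∣ + X                      ≤⟨ +-monoˡ-≤ X (m≤m+n ∣ weightSum φ N ∣ (2 * M)) ⟩
      ∣ weightSum φ N ∣ + 2 * M + X              ≤⟨ +-monoˡ-≤ X descent ⟩
      ∣ weightSum ψ N′ ∣ + 2 ^ suc H * M + X     ≡⟨ cong (λ y → ∣ weightSum ψ N′ ∣ + y + X) (*-assoc 2 B M) ⟩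
      ∣ weightSum ψ N′ ∣ + X + X                 ≡⟨ +-assoc ∣ weightSum ψ N′ ∣ X X ⟩
      ∣ weightSum ψ N′ ∣ + (X + X)               ≤⟨ +-monoʳ-≤ ∣ weightSum ψ N′ ∣ X+X≤DX ⟩
      ∣ weightSum ψ N′ ∣ + D * X                 ≡⟨ cong (∣ weightSum ψ N′ ∣ +_) (regroup B M D) ⟩
      ∣ weightSum ψ N′ ∣ + 2 * (B * (M * D))     ≤⟨ weightSum-geometric t (contracting-pairSum^ {M} contr) N′ N′<B^t ⟩
      2 * (B * (M * D)) * D ^ t                  ≡⟨ regroup′ B M D (D ^ t) ⟩
      2 * (B * M) * D ^ suc t                    ∎
      where
      open ≤-Reasoning
      X = 2 * (B * M)
      ψ = (pairSum ^ᵉ H) φ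
      X+X≤DX : X + X ≤ D * X
      X+X≤DX = subst (_≤ D * X) (cong (X +_) (+-identityʳ X)) (*-monoˡ-≤ X 2≤D)
      regroup : ∀ B M D → D * (2 * (B * M)) ≡ 2 * (B * (M * D))
      regroup = ℕ-Solver.solve-∀
      regroup′ : ∀ B M D x → 2 * (B * (M * D)) * x ≡ 2 * (B * M) * (D * x)
      regroup′ = ℕ-Solver.solve-∀

    weightSum-bound : ∀ {M φ} → Contracting M φ → ∀ t N → N < B ^ t → ∣ weightSum φ N ∣ ≤ 2 * (B * M) * D ^ t
    weightSum-bound contr t N N<B^t = m+n≤o⇒m≤o _ (weightSum-geometric t contr N N<B^t)

    contracting⇒powerSaving : ∀ {M φ} e → Contracting M φ → PowerSaving (λ N → e + ∣ weightSum φ N ∣)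
    contracting⇒powerSaving {M} {φ} e contr =
      geometric⇒powerSaving {K = e + 2 * (B * M)} (≤-trans (s≤s z≤n) 2≤D) geometric
      where
      geometric : ∀ t N → N < (D + 2) ^ t → e + ∣ weightSum φ N ∣ ≤ (e + 2 * (B * M)) * D ^ t
      geometric t N N<[D+2]^t = begin
        e + ∣ weightSum φ N ∣              ≤⟨ +-mono-≤ (m≤m*n e (D ^ t) {{D^t≢0}})
                                                 (weightSum-bound contr t N (subst (λ b → N < b ^ t) D+2≡B N<[D+2]^t)) ⟩
        e * D ^ t + 2 * (B * M) * D ^ t   ≡⟨ sym (*-distribʳ-+ (D ^ t) e (2 * (B * M))) ⟩
        (e + 2 * (B * M)) * D ^ t         ∎
        where
        open ≤-Reasoning
        D^t≢0 : NonZero (D ^ t)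
        D^t≢0 = m^n≢0 D t {{>-nonZero (≤-trans (s≤s z≤n) 2≤D)}}

module _ (a : Fin 2) (ℓ : ℕ) (2≤ℓ : 2 ≤ ℓ) where
  open WeightSums a
  open Contraction ℓ 2≤ℓ
  open AffineDecomposition ℓ 2≤ℓ

  S-replicate : ∀ N → S (replicate ℓ a) N ≡ binomialSign ℓ (weight 0) ℤ.+ weightSum (binomialSign ℓ) N
  S-replicate zero    = trans (sign-occ-replicate a (bin 0) ℓ) (sym (ℤₚ.+-identityʳ _))
  S-replicate (suc N) = trans (cong₂ ℤ._+_ (S-replicate N) (sign-occ-replicate a (bin (suc N)) ℓ))
                              (ℤₚ.+-assoc (binomialSign ℓ (weight 0)) (weightSum (binomialSign ℓ) N) _)

  ∣S∣≤1+∣weightSum∣ : ∀ N → ∣ S (replicate ℓ a) N ∣ ≤ 1 + ∣ weightSum (binomialSign ℓ) N ∣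
  ∣S∣≤1+∣weightSum∣ N = begin
    ∣ S (replicate ℓ a) N ∣  ≡⟨ cong ∣_∣ (S-replicate N) ⟩
    ∣ f₀ ℤ.+ W ∣             ≤⟨ ℤₚ.∣i+j∣≤∣i∣+∣j∣ f₀ W ⟩
    ∣ f₀ ∣ + ∣ W ∣           ≤⟨ +-monoˡ-≤ ∣ W ∣ (binomialSign-bounded ℓ (weight 0)) ⟩
    1 + ∣ W ∣                ∎
    where
    open ≤-Reasoning
    f₀ = binomialSign ℓ (weight 0)
    W = weightSum (binomialSign ℓ) N

  ∣weightSum∣≤∣S∣+1 : ∀ N → ∣ weightSum (binomialSign ℓ) N ∣ ≤ ∣ S (replicate ℓ a) N ∣ + 1
  ∣weightSum∣≤∣S∣+1 N = begin
    ∣ W ∣                          ≡⟨ cong ∣_∣ (trans (isolate f₀ W) (cong (ℤ._- f₀) (sym (S-replicate N)))) ⟩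
    ∣ S (replicate ℓ a) N ℤ.- f₀ ∣ ≤⟨ ℤₚ.∣i-j∣≤∣i∣+∣j∣ (S (replicate ℓ a) N) f₀ ⟩
    ∣ S (replicate ℓ a) N ∣ + ∣ f₀ ∣ ≤⟨ +-monoʳ-≤ ∣ S (replicate ℓ a) N ∣ (binomialSign-bounded ℓ (weight 0)) ⟩
    ∣ S (replicate ℓ a) N ∣ + 1      ∎
    where
    open ≤-Reasoning
    f₀ = binomialSign ℓ (weight 0)
    W = weightSum (binomialSign ℓ) N
    isolate : ∀ x y → y ≡ x ℤ.+ y ℤ.- x
    isolate = ℤ-Solver.solve-∀

  powerOf2⇒PropertyP : IsPowerOf2 ℓ → PropertyP (replicate ℓ a)
  powerOf2⇒PropertyP (j , ℓ≡2^j) = powerSaving-mono ∣S∣≤1+∣weightSum∣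
    (contracting⇒powerSaving ℓ 2≤ℓ {1} {binomialSign ℓ} 1
      (antiperiodic⇒contracting (≤-trans (s≤s z≤n) 2≤ℓ) ≤-refl antiperiodic (binomialSign-bounded ℓ)))
    where
    antiperiodic : Antiperiodic ℓ (binomialSign ℓ)
    antiperiodic = subst (λ d → Antiperiodic d (binomialSign d)) (sym ℓ≡2^j) (binomialSign-antiperiodic j)

  affine⇒S-lower-bound : ∀ {σ c ψ} → (∀ k → ℤ.+ σ ℤ.* binomialSign ℓ k ≡ ℤ.+ c ℤ.+ ψ k) →
                         ∀ N → c * N ≤ σ * (∣ S (replicate ℓ a) N ∣ + 1) + ∣ weightSum ψ N ∣
  affine⇒S-lower-bound {σ} {c} {ψ} decomp N = begin
    c * N                                      ≡⟨ sym (ℤₚ.∣i*j∣≡∣i∣*∣j∣ (ℤ.+ c) (ℤ.+ N)) ⟩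
    ∣ ℤ.+ c ℤ.* ℤ.+ N ∣                        ≡⟨ cong ∣_∣ (isolate (weightSum-affine {σ} {c} {binomialSign ℓ} {ψ} decomp N)) ⟩
    ∣ ℤ.+ σ ℤ.* W ℤ.- Ψ ∣                      ≤⟨ ℤₚ.∣i-j∣≤∣i∣+∣j∣ (ℤ.+ σ ℤ.* W) Ψ ⟩
    ∣ ℤ.+ σ ℤ.* W ∣ + ∣ Ψ ∣                    ≡⟨ cong (_+ ∣ Ψ ∣) (ℤₚ.∣i*j∣≡∣i∣*∣j∣ (ℤ.+ σ) W) ⟩
    σ * ∣ W ∣ + ∣ Ψ ∣                          ≤⟨ +-monoˡ-≤ ∣ Ψ ∣ (*-monoʳ-≤ σ (∣weightSum∣≤∣S∣+1 N)) ⟩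
    σ * (∣ S (replicate ℓ a) N ∣ + 1) + ∣ Ψ ∣  ∎
    where
    open ≤-Reasoning
    W = weightSum (binomialSign ℓ) N
    Ψ = weightSum ψ N
    cancel : ∀ y z → y ≡ y ℤ.+ z ℤ.- z
    cancel = ℤ-Solver.solve-∀
    isolate : ℤ.+ σ ℤ.* W ≡ ℤ.+ c ℤ.* ℤ.+ N ℤ.+ Ψ → ℤ.+ c ℤ.* ℤ.+ N ≡ ℤ.+ σ ℤ.* W ℤ.- Ψ
    isolate σW≡cN+Ψ = trans (cancel (ℤ.+ c ℤ.* ℤ.+ N) Ψ) (cong (ℤ._- Ψ) (sym σW≡cN+Ψ))

  affinelyContracting⇒¬PropertyP : ∀ {c} → 1 ≤ c → AffinelyContracting c (binomialSign ℓ) →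
                                   ¬ PropertyP (replicate ℓ a)
  affinelyContracting⇒¬PropertyP {c} 1≤c (σ , M , ψ , _ , contr , decomp) P =
    sublinear⇒⊥ (powerSaving⇒sublinear {λ N → ∣ S (replicate ℓ a) N ∣} P (4 * σ))
                (powerSaving⇒sublinear (contracting⇒powerSaving ℓ 2≤ℓ {M} {ψ} 0 contr) 4)
    where
    sublinear⇒⊥ : (∃[ N₁ ] ∀ N → N₁ ≤ N → 4 * σ * ∣ S (replicate ℓ a) N ∣ ≤ N) →
                  (∃[ N₂ ] ∀ N → N₂ ≤ N → 4 * ∣ weightSum ψ N ∣ ≤ N) → ⊥
    sublinear⇒⊥ (N₁ , S-sublinear) (N₂ , ψ-sublinear) = <⇒≱ (*-monoˡ-< N (≤-refl {4})) (begin
      4 * N                        ≤⟨ *-monoʳ-≤ 4 (m≤n*m N c {{>-nonZero 1≤c}}) ⟩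
      4 * (c * N)                  ≤⟨ *-monoʳ-≤ 4 (affine⇒S-lower-bound {σ} {c} {ψ} decomp N) ⟩
      4 * (σ * (Sₙ + 1) + Ψ)       ≡⟨ expand σ Sₙ Ψ ⟩
      4 * σ * Sₙ + 4 * σ + 4 * Ψ   ≤⟨ +-mono-≤ (+-mono-≤ (S-sublinear N N₁≤N) 4σ≤N) (ψ-sublinear N N₂≤N) ⟩
      N + N + N                    ≡⟨ triple N ⟩
      3 * N                        ∎)
      where
      open ≤-Reasoning
      N = suc (N₁ + N₂ + 4 * σ)
      Sₙ = ∣ S (replicate ℓ a) N ∣
      Ψ = ∣ weightSum ψ N ∣
      N₁≤N : N₁ ≤ N
      N₁≤N = m≤n⇒m≤1+n (≤-trans (m≤m+n N₁ N₂) (m≤m+n (N₁ + N₂) (4 * σ)))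
      N₂≤N : N₂ ≤ N
      N₂≤N = m≤n⇒m≤1+n (≤-trans (m≤n+m N₂ N₁) (m≤m+n (N₁ + N₂) (4 * σ)))
      4σ≤N : 4 * σ ≤ N
      4σ≤N = m≤n⇒m≤1+n (m≤n+m (4 * σ) (N₁ + N₂))
      expand : ∀ σ s ψ → 4 * (σ * (s + 1) + ψ) ≡ 4 * σ * s + 4 * σ + 4 * ψ
      expand = ℕ-Solver.solve-∀
      triple : ∀ n → n + n + n ≡ 3 * n
      triple = ℕ-Solver.solve-∀

  PropertyP⇒powerOf2 : PropertyP (replicate ℓ a) → IsPowerOf2 ℓ
  PropertyP⇒powerOf2 P with top-bit (≤-trans (s≤s z≤n) 2≤ℓ)
  ... | j , zero      , ℓ≡2^j+0 , _     = j , trans ℓ≡2^j+0 (+-identityʳ (2 ^ j))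
  ... | j , t@(suc _) , ℓ≡2^j+t , t<2^j =
    ⊥-elim (not-affine (binomialSign-affine t (s≤s z≤n) (subst (t ≤_) (sym ℓ≡2^j+t) (m≤n+m t (2 ^ j)))))
    where
    not-affine : ∃[ c ] AffinelyContracting c (binomialSign t) → ⊥
    not-affine (_ , affine-t)
      with binomialSign-affine-step j t<2^j (subst (2 ^ j ≤_) (sym ℓ≡2^j+t) (m≤m+n (2 ^ j) t)) affine-t
    ... | _ , 1≤c′ , affine-ℓ = affinelyContracting⇒¬PropertyP 1≤c′
                                  (subst (λ h → AffinelyContracting _ (binomialSign h)) (sym ℓ≡2^j+t) affine-ℓ) P

theorem7p2 : (a : Fin 2) (ℓ : ℕ) → 2 ≤ ℓ →
    PropertyP (replicate ℓ a) ⇔ IsPowerOf2 ℓ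
theorem7p2 a ℓ 2≤ℓ = mk⇔ (PropertyP⇒powerOf2 a ℓ 2≤ℓ) (powerOf2⇒PropertyP a ℓ 2≤ℓ)
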